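{- Let $k \geq 1$ be an integer and let $(G,\Sigma)$ be a $k$-frustrated signed graph. The following statements are equivalent: (1) $(G,\Sigma)$ is $k$-critical; (2) every edge of $G$ is contained in some $k$-signature of $(G,\Sigma)$; (3) for every $k$-signature $\Gamma$ of $(G,\Sigma)$, every edge $e \in E(G)\setminus \Gamma$ is contained in an equilibrated edge-cut of $(G,\Gamma)$.
   Context: A signed graph $(G,\Sigma)$ is a finite graph $G$ (loops and multiple edges allowed) together with a set $\Sigma \subseteq E(G)$ of negative edges; all other edges are positive. A circuit is negative if it contains an odd number of edges of $\Sigma$; $(G,\Sigma)$ is balanced if it has no negative circuit. For $U \subseteq V(G)$, the edge-cut $\partial(U)$ is the set of edges with exactly one end in $U$. Two signatures $\Sigma,\Gamma$ on $G$ are equivalent if $\Gamma = \Sigma \,\Delta\, \partial(U)$ for some $U\subseteq V(G)$ ($\Delta$ = symmetric difference); any set $\Gamma$ equivalent to $\Sigma$ is called a signature of $(G,\Sigma)$, and a $t$-signature if $|\Gamma|=t$. The frustration index $l(G,\Sigma)$ is the minimum cardinality of $E\subseteq E(G)$ with $(G-E,\Sigma-E)$ balanced; $(G,\Sigma)$ is $k$-frustrated if $l(G,\Sigma)=k$, and $k$-critical if moreover $l(G-e,\Sigma-\{e\})<k$ for every $e\in E(G)$. An edge-cut $\partial(U)$ of $(G,\Gamma)$ is equilibrated if it contains equally many edges of $\Gamma$ and of $E(G)\setminus\Gamma$. -}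

module Defs where

open import Data.Nat using (ℕ; zero; suc; _<_; _≤_; _%_)
open import Data.Bool using (Bool; true; false; if_then_else_; _xor_)
open import Data.Fin using (Fin; zero; suc; punchIn)
open import Data.Fin.Subset using (Subset; ∣_∣; _∩_; ∁; _∈_)
open import Data.Vec using (Vec; lookup; tabulate; zipWith)
open import Data.List using (map; allFin)
open import Data.Nat.ListAction using (sum)
open import Data.Product using (_×_; _,_; ∃; Σ-syntax)
open import Data.Sum using (_⊎_)
open import Relation.Nullary using (¬_)
open import Relation.Binary.PropositionalEquality using (_≡_)
open import Function.Definitions using (Injective)

-- A (finite multi-)graph with vertex set Fin n and edge set Fin m;
-- each edge has a (possibly equal) pair of end vertices.
-- Loops and parallel edges are allowed.
Graph : ℕ → ℕ → Set
Graph n m = Fin m → Fin n × Fin n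

Joins : ∀ {n m} → Graph n m → Fin m → Fin n → Fin n → Set
Joins G e u v = (G e ≡ (u , v)) ⊎ (G e ≡ (v , u))

next : ∀ {l} → Fin (suc l) → Fin (suc l)
next {zero} zero = zero
next {suc l} zero = suc zero
next {suc l} (suc i) with next {l} i
... | zero = zero
... | suc j = suc (suc j)

-- A circuit of length (suc len): distinct vertices v_0..v_len and distinct
-- edges e_0..e_len with e_i joining v_i and v_{i+1 mod (len+1)}.
-- (Length 1 = a loop, length 2 = a pair of parallel edges.)
record Circuit {n m : ℕ} (G : Graph n m) : Set where
  field
    len   : ℕ
    verts : Fin (suc len) → Fin n
    edges : Fin (suc len) → Fin m
    verts-inj : Injective _≡_ _≡_ verts
    edges-inj : Injective _≡_ _≡_ edges
    joins : ∀ i → Joins G (edges i) (verts i) (verts (next i))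

open Circuit public

negCount : ∀ {n m} {G : Graph n m} → Subset m → Circuit G → ℕ
negCount Σ C = sum (map (λ i → if lookup Σ (edges C i) then 1 else 0) (allFin (suc (len C))))

Negative : ∀ {n m} {G : Graph n m} → Subset m → Circuit G → Set
Negative Σ C = negCount Σ C % 2 ≡ 1

-- (G - D, Σ - D) is balanced: no negative circuit avoiding D.
BalancedWithout : ∀ {n m} → Graph n m → Subset m → Subset m → Set
BalancedWithout G Σ D = ∀ (C : Circuit G) → (∀ i → lookup D (edges C i) ≡ false) → ¬ Negative Σ C

Frustration : ∀ {n m} → Graph n m → Subset m → ℕ → Set
Frustration {m = m} G Σ k =
  (∃ λ (D : Subset m) → ∣ D ∣ ≡ k × BalancedWithout G Σ D) ×
  (∀ (D : Subset m) → BalancedWithout G Σ D → k ≤ ∣ D ∣)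

deleteEdge : ∀ {n m} → Graph n (suc m) → Fin (suc m) → Graph n m
deleteEdge G e j = G (punchIn e j)

deleteSig : ∀ {m} → Subset (suc m) → Fin (suc m) → Subset m
deleteSig Σ e = tabulate (λ j → lookup Σ (punchIn e j))

DeletionBelow : ∀ {n m} → Graph n m → Subset m → Fin m → ℕ → Set
DeletionBelow {m = zero} G Σ () k
DeletionBelow {m = suc m} G Σ e k =
  ∃ λ j → j < k × Frustration (deleteEdge G e) (deleteSig Σ e) j

Critical : ∀ {n m} → Graph n m → Subset m → ℕ → Set
Critical {m = m} G Σ k = Frustration G Σ k × (∀ (e : Fin m) → DeletionBelow G Σ e k)

cut : ∀ {n m} → Graph n m → Subset n → Subset m
cut G U = tabulate (λ e → lookup U (Data.Product.proj₁ (G e)) xor lookup U (Data.Product.proj₂ (G e)))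

_Δ_ : ∀ {m} → Subset m → Subset m → Subset m
A Δ B = zipWith _xor_ A B

IsSignature : ∀ {n m} → Graph n m → Subset m → Subset m → Set
IsSignature {n = n} G Σ Γ = ∃ λ (U : Subset n) → Γ ≡ Σ Δ cut G U

IsKSignature : ∀ {n m} → Graph n m → Subset m → ℕ → Subset m → Set
IsKSignature G Σ k Γ = IsSignature G Σ Γ × ∣ Γ ∣ ≡ k

Equilibrated : ∀ {n m} → Graph n m → Subset m → Subset n → Set
Equilibrated G Γ U = ∣ cut G U ∩ Γ ∣ ≡ ∣ cut G U ∩ ∁ Γ ∣

{-# OPTIONS --safe #-}
module Submission where

-- Switching Σ to Σ Δ ∂(U) preserves the sign of every circuit, so deleting any signature leaves a
-- balanced graph; conversely (Harary), if G − D is balanced then some signature lies inside D. Hence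
-- l(G,Σ) is the least size of a signature, and deleting e lowers it exactly when e lies in some
-- k-signature: this is (1) ⇔ (2). Any two signatures are related by Γ′ = Γ Δ ∂(W); they have the
-- same size exactly when ∂(W) is equilibrated in (G,Γ), and an edge e ∉ Γ lies in Γ′ exactly when
-- e ∈ ∂(W): this is (2) ⇔ (3).

open import Defs
open import Algebra.Bundles using (CommutativeRing)
open import Data.Bool using (Bool; true; false; not; _xor_; if_then_else_)
import Data.Bool as Bool
open import Data.Bool.Properties
  using (xor-∧-commutativeRing; xor-assoc; xor-comm; xor-same; xor-identityʳ; not-involutive; ¬-not)
open import Data.Empty using (⊥-elim)
open import Data.Fin using (Fin; zero; suc; inject₁; fromℕ; punchIn; _≟_)
open import Data.Fin.Properties using (any?)
open import Data.Fin.Subset using (Subset; ∣_∣; _∈_; _∉_; _⊆_; _∩_; ∁; ⁅_⁆; ⊥)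
open import Data.Fin.Subset.Properties using (∣p∣≤n; p⊆q⇒∣p∣≤∣q∣; ⊆-refl; x∈⁅x⁆; x∈⁅y⁆⇒x≡y; _∈?_)
open import Data.List as List using (List; []; _∷_; allFin)
open import Data.List.Properties using (map-tabulate)
open import Data.List.Membership.Propositional using () renaming (_∈_ to _∈ₗ_)
open import Data.List.Membership.Propositional.Properties using (∈-allFin)
import Data.List.Membership.DecPropositional as DecMembership
open import Data.List.Relation.Unary.Any using (here; there)
open import Data.Nat using (ℕ; zero; suc; _+_; _%_; _≤_; _<_; _≤?_)
open import Data.Nat.DivMod using (%-distribˡ-+)
open import Data.Nat.ListAction using (sum)
import Data.Nat.Properties as ℕ
open import Data.Nat.Properties
  using (+-suc; +-cancelˡ-≡; +-cancelʳ-≡; m≤m+n; n≮n; ≤-refl; ≤-reflexive; ≤-trans;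
         ≤-antisym; ≰⇒≥; <-≤-trans; ≤-<-trans)
open import Data.Product using (_×_; _,_; ∃; Σ-syntax; proj₁; proj₂)
open import Data.Sum using (_⊎_; inj₁; inj₂)
open import Data.Vec using ([]; _∷_; lookup; _[_]≔_)
open import Data.Vec.Properties
  using (lookup-zipWith; zipWith-assoc; lookup∘tabulate; tabulate∘lookup; tabulate-cong; []=⇒lookup; lookup⇒[]=;
         lookup∘update; lookup∘update′)
import Data.Vec.Functional as Vector
open import Function using (_∘_; id)
open import Function.Bundles using (_⇔_; mk⇔; Equivalence)
open import Function.Definitions using (Injective)
open import Level using (0ℓ)
open import Relation.Binary.PropositionalEquality
open import Relation.Nullary using (Dec; yes; no; ¬?)
open import Relation.Nullary.Decidable using (_×-dec_; decidable-stable)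
open import Relation.Unary using (Pred; Decidable)

open CommutativeRing xor-∧-commutativeRing
  using () renaming (+-commutativeMonoid to xor-commutativeMonoid; +-commutativeSemigroup to xor-commutativeSemigroup)
open import Algebra.Properties.CommutativeMonoid.Sum xor-commutativeMonoid
  using (sum-cong-≗; sum-replicate-zero; sum-init-last; ∑-distrib-+)
  renaming (sum to xorSum)
open import Algebra.Properties.CommutativeSemigroup xor-commutativeSemigroup using (interchange)
open import Algebra.Properties.CommutativeSemigroup ℕ.+-commutativeSemigroup
  using () renaming (x∙yz≈y∙xz to +-left-comm)

open ≡-Reasoning

bit : Bool → ℕ
bit b = if b then 1 else 0

true≢false : true ≢ false
true≢false ()

xorSum-false : ∀ {k} {f : Fin k → Bool} → (∀ i → f i ≡ false) → xorSum f ≡ false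
xorSum-false {k} f≡false = trans (sum-cong-≗ f≡false) (sum-replicate-zero k)

next-inject₁ : ∀ {l} (i : Fin l) → next (inject₁ i) ≡ suc i
next-inject₁ {suc l} zero = refl
next-inject₁ {suc l} (suc i) rewrite next-inject₁ i = refl

next-fromℕ : ∀ l → next (fromℕ l) ≡ zero
next-fromℕ zero = refl
next-fromℕ (suc l) rewrite next-fromℕ l = refl

xorSum-next : ∀ {l} (g : Fin (suc l) → Bool) → xorSum (g ∘ next) ≡ xorSum g
xorSum-next {l} g = begin
  xorSum (g ∘ next)                                   ≡⟨ sum-init-last (g ∘ next) ⟩
  xorSum (g ∘ next ∘ inject₁) xor g (next (fromℕ l))  ≡⟨ cong₂ _xor_ (sum-cong-≗ (cong g ∘ next-inject₁))
                                                                     (cong g (next-fromℕ l)) ⟩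
  xorSum (g ∘ suc) xor g zero                          ≡⟨ xor-comm (xorSum (g ∘ suc)) (g zero) ⟩
  xorSum g                                             ∎

xorSum-coboundary : ∀ {l} (h : Fin (suc l) → Bool) → xorSum (λ i → h i xor h (next i)) ≡ false
xorSum-coboundary h = begin
  xorSum (λ i → h i xor h (next i)) ≡⟨ ∑-distrib-+ h (h ∘ next) ⟩
  xorSum h xor xorSum (h ∘ next)     ≡⟨ cong (xorSum h xor_) (xorSum-next h) ⟩
  xorSum h xor xorSum h              ≡⟨ xor-same (xorSum h) ⟩
  false                              ∎

sum-bits-mod2 : ∀ {k} (g : Fin k → Bool) → sum (List.tabulate (bit ∘ g)) % 2 ≡ bit (xorSum g)
sum-bits-mod2 {zero} g = refl
sum-bits-mod2 {suc k} g with g zero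
... | false = sum-bits-mod2 (g ∘ suc)
... | true = begin
  suc s % 2        ≡⟨ %-distribˡ-+ 1 s 2 ⟩
  suc (s % 2) % 2  ≡⟨ cong (λ r → suc r % 2) (sum-bits-mod2 (g ∘ suc)) ⟩
  suc (bit b) % 2  ≡⟨ suc-bit-mod2 b ⟩
  bit (not b)      ∎
  where
    s : ℕ
    s = sum (List.tabulate (bit ∘ g ∘ suc))
    b : Bool
    b = xorSum (g ∘ suc)
    suc-bit-mod2 : ∀ b → suc (bit b) % 2 ≡ bit (not b)
    suc-bit-mod2 true = refl
    suc-bit-mod2 false = refl

-- Signs of circuits and switching

sign : ∀ {n m} {G : Graph n m} → Subset m → Circuit G → Bool
sign Σ C = xorSum (λ i → lookup Σ (edges C i))

negCount-mod2 : ∀ {n m} {G : Graph n m} (Σ : Subset m) (C : Circuit G) → negCount Σ C % 2 ≡ bit (sign Σ C)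
negCount-mod2 Σ C = trans (cong (λ xs → sum xs % 2) (map-tabulate id (bit ∘ σ))) (sum-bits-mod2 σ)
  where
    σ : Fin (suc (len C)) → Bool
    σ i = lookup Σ (edges C i)

negative⇔sign : ∀ {n m} {G : Graph n m} (Σ : Subset m) (C : Circuit G) → Negative Σ C ⇔ sign Σ C ≡ true
negative⇔sign Σ C = mk⇔ (λ neg → bit≡1 (trans (sym (negCount-mod2 Σ C)) neg))
                        (λ s → trans (negCount-mod2 Σ C) (cong bit s))
  where
    bit≡1 : ∀ {b} → bit b ≡ 1 → b ≡ true
    bit≡1 {true} _ = refl

switch : ∀ {n m} → Graph n m → Subset n → Subset m → Subset m
switch G U Σ = Σ Δ cut G U

lookup-Δ : ∀ {k} (A B : Subset k) i → lookup (A Δ B) i ≡ lookup A i xor lookup B i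
lookup-Δ A B i = lookup-zipWith _xor_ i A B

lookup-cut : ∀ {n m} (G : Graph n m) (U : Subset n) a →
  lookup (cut G U) a ≡ lookup U (proj₁ (G a)) xor lookup U (proj₂ (G a))
lookup-cut G U a = lookup∘tabulate _ a

lookup-cut-joins : ∀ {n m} (G : Graph n m) (U : Subset n) {a x y} → Joins G a x y →
  lookup (cut G U) a ≡ lookup U x xor lookup U y
lookup-cut-joins G U {a} (inj₁ Ga≡xy) rewrite lookup-cut G U a | Ga≡xy = refl
lookup-cut-joins G U {a} {x} {y} (inj₂ Ga≡yx) rewrite lookup-cut G U a | Ga≡yx = xor-comm (lookup U y) (lookup U x)

lookup-extensional : ∀ {k} {A B : Subset k} → (∀ i → lookup A i ≡ lookup B i) → A ≡ B
lookup-extensional {A = A} {B} eq =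
  trans (sym (tabulate∘lookup A)) (trans (tabulate-cong eq) (tabulate∘lookup B))

cut-Δ : ∀ {n m} (G : Graph n m) (U W : Subset n) → cut G (U Δ W) ≡ cut G U Δ cut G W
cut-Δ {n} {m} G U W = lookup-extensional λ a → begin
  lookup (cut G (U Δ W)) a                          ≡⟨ lookup-cut G (U Δ W) a ⟩
  lookup (U Δ W) (s a) xor lookup (U Δ W) (t a)    ≡⟨ cong₂ _xor_ (lookup-Δ U W (s a)) (lookup-Δ U W (t a)) ⟩
  (lookup U (s a) xor lookup W (s a)) xor (lookup U (t a) xor lookup W (t a))
                                                    ≡⟨ interchange (lookup U (s a)) (lookup W (s a)) (lookup U (t a)) (lookup W (t a)) ⟩
  (lookup U (s a) xor lookup U (t a)) xor (lookup W (s a) xor lookup W (t a))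
                                                    ≡⟨ sym (cong₂ _xor_ (lookup-cut G U a) (lookup-cut G W a)) ⟩
  lookup (cut G U) a xor lookup (cut G W) a         ≡⟨ sym (lookup-Δ (cut G U) (cut G W) a) ⟩
  lookup (cut G U Δ cut G W) a                      ∎
  where
    s t : Fin m → Fin n
    s a = proj₁ (G a)
    t a = proj₂ (G a)

Δ-assoc : ∀ {k} (A B C : Subset k) → (A Δ B) Δ C ≡ A Δ (B Δ C)
Δ-assoc = zipWith-assoc xor-assoc

Δ-cancelˡ : ∀ {k} (A B : Subset k) → A Δ (A Δ B) ≡ B
Δ-cancelˡ A B = lookup-extensional λ i →
  trans (lookup-Δ A (A Δ B) i)
        (trans (cong (lookup A i xor_) (lookup-Δ A B i)) (xor-cancelˡ (lookup A i) (lookup B i)))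
  where
    xor-cancelˡ : ∀ x y → x xor (x xor y) ≡ y
    xor-cancelˡ true y = not-involutive y
    xor-cancelˡ false y = refl

switch-Δ : ∀ {n m} (G : Graph n m) (U W : Subset n) (Σ : Subset m) →
  switch G (U Δ W) Σ ≡ switch G W (switch G U Σ)
switch-Δ G U W Σ = trans (cong (Σ Δ_) (cut-Δ G U W)) (sym (Δ-assoc Σ (cut G U) (cut G W)))

lookup-switch-Δ : ∀ {n m} (G : Graph n m) (U W : Subset n) (Σ : Subset m) a →
  lookup (switch G (U Δ W) Σ) a ≡ lookup (switch G U Σ) a xor lookup (cut G W) a
lookup-switch-Δ G U W Σ a =
  trans (cong (λ Γ → lookup Γ a) (switch-Δ G U W Σ)) (lookup-Δ (switch G U Σ) (cut G W) a)

switch-difference : ∀ {n m} (G : Graph n m) (U₀ U₁ : Subset n) (Σ : Subset m) →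
  switch G U₁ Σ ≡ switch G (U₀ Δ U₁) (switch G U₀ Σ)
switch-difference G U₀ U₁ Σ = begin
  switch G U₁ Σ                         ≡⟨ cong (λ U → switch G U Σ) (sym (Δ-cancelˡ U₀ U₁)) ⟩
  switch G (U₀ Δ (U₀ Δ U₁)) Σ           ≡⟨ switch-Δ G U₀ (U₀ Δ U₁) Σ ⟩
  switch G (U₀ Δ U₁) (switch G U₀ Σ)    ∎

sign-switch : ∀ {n m} {G : Graph n m} (Σ : Subset m) (U : Subset n) (C : Circuit G) →
  sign (switch G U Σ) C ≡ sign Σ C
sign-switch {G = G} Σ U C = begin
  xorSum (λ i → lookup (switch G U Σ) (edges C i))  ≡⟨ sum-cong-≗ switched ⟩
  xorSum (λ i → σ i xor (h i xor h (next i)))       ≡⟨ ∑-distrib-+ σ (λ i → h i xor h (next i)) ⟩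
  sign Σ C xor xorSum (λ i → h i xor h (next i))    ≡⟨ cong (sign Σ C xor_) (xorSum-coboundary h) ⟩
  sign Σ C xor false                                ≡⟨ xor-identityʳ (sign Σ C) ⟩
  sign Σ C                                          ∎
  where
    σ h : Fin (suc (len C)) → Bool
    σ i = lookup Σ (edges C i)
    h i = lookup U (verts C i)
    switched : ∀ i → lookup (switch G U Σ) (edges C i) ≡ σ i xor (h i xor h (next i))
    switched i = trans (lookup-Δ Σ (cut G U) (edges C i)) (cong (σ i xor_) (lookup-cut-joins G U (joins C i)))

⊆⇒lookup-false : ∀ {k} {p q : Subset k} → p ⊆ q → ∀ x → lookup q x ≡ false → lookup p x ≡ false
⊆⇒lookup-false {p = p} {q} p⊆q x qx≡false with lookup p x in px
... | false = refl
... | true = ⊥-elim (true≢false (trans (sym ([]=⇒lookup (p⊆q (lookup⇒[]= x p px)))) qx≡false))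

switch⊆⇒balanced : ∀ {n m} (G : Graph n m) (Σ D : Subset m) (U : Subset n) →
  switch G U Σ ⊆ D → BalancedWithout G Σ D
switch⊆⇒balanced G Σ D U Γ⊆D C avoids neg = true≢false (begin
  true                   ≡⟨ sym (Equivalence.to (negative⇔sign Σ C) neg) ⟩
  sign Σ C               ≡⟨ sym (sign-switch Σ U C) ⟩
  sign (switch G U Σ) C  ≡⟨ xorSum-false (λ i → ⊆⇒lookup-false Γ⊆D (edges C i) (avoids i)) ⟩
  false                  ∎)

joins-endpoint : ∀ {n m} {G : Graph n m} {a x y u w} → Joins G a x y → Joins G a u w → u ≡ x ⊎ u ≡ y
joins-endpoint (inj₁ Ga≡xy) (inj₁ Ga≡uw) = inj₁ (cong proj₁ (trans (sym Ga≡uw) Ga≡xy))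
joins-endpoint (inj₁ Ga≡xy) (inj₂ Ga≡wu) = inj₂ (cong proj₂ (trans (sym Ga≡wu) Ga≡xy))
joins-endpoint (inj₂ Ga≡yx) (inj₁ Ga≡uw) = inj₂ (cong proj₁ (trans (sym Ga≡uw) Ga≡yx))
joins-endpoint (inj₂ Ga≡yx) (inj₂ Ga≡wu) = inj₁ (cong proj₂ (trans (sym Ga≡wu) Ga≡yx))

_∷ʳ_ : ∀ {A : Set} {l} → (Fin l → A) → A → Fin (suc l) → A
_∷ʳ_ {l = zero} f a zero = a
_∷ʳ_ {l = suc l} f a zero = f zero
_∷ʳ_ {l = suc l} f a (suc i) = ((f ∘ suc) ∷ʳ a) i

∷ʳ-inject₁ : ∀ {A : Set} {l} (f : Fin l → A) a (i : Fin l) → (f ∷ʳ a) (inject₁ i) ≡ f i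
∷ʳ-inject₁ {l = suc l} f a zero = refl
∷ʳ-inject₁ {l = suc l} f a (suc i) = ∷ʳ-inject₁ (f ∘ suc) a i

∷ʳ-fromℕ : ∀ {A : Set} {l} (f : Fin l → A) a → (f ∷ʳ a) (fromℕ l) ≡ a
∷ʳ-fromℕ {l = zero} f a = refl
∷ʳ-fromℕ {l = suc l} f a = ∷ʳ-fromℕ (f ∘ suc) a

data InitOrLast : ∀ {l} → Fin (suc l) → Set where
  init : ∀ {l} (i : Fin l) → InitOrLast (inject₁ i)
  last : ∀ {l} → InitOrLast (fromℕ l)

initOrLast : ∀ {l} (i : Fin (suc l)) → InitOrLast i
initOrLast {zero} zero = last
initOrLast {suc l} zero = init zero
initOrLast {suc l} (suc i) with initOrLast i
... | init j = init (suc j)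
... | last = last

lookup-insert : ∀ {k} (R : Subset k) w {z} → lookup R z ≡ true → lookup (R [ w ]≔ true) z ≡ true
lookup-insert R w {z} z∈R with w ≟ z
... | yes refl = lookup∘update w R true
... | no w≢z = trans (lookup∘update′ (w≢z ∘ sym) R true) z∈R

∣insert∣ : ∀ {k} (R : Subset k) w → lookup R w ≡ false → ∣ R [ w ]≔ true ∣ ≡ suc ∣ R ∣
∣insert∣ (false ∷ R) zero _ = refl
∣insert∣ (true ∷ R) (suc w) w∉R = cong suc (∣insert∣ R w w∉R)
∣insert∣ (false ∷ R) (suc w) w∉R = ∣insert∣ R w w∉R

module Reachability {n m} (G : Graph n m) (P : Pred (Fin m) 0ℓ) where

  record Path (x y : Fin n) : Set where
    field
      steps            : ℕ
      vertex           : Fin (suc steps) → Fin n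
      edge             : Fin steps → Fin m
      vertex-injective : Injective _≡_ _≡_ vertex
      edge-injective   : Injective _≡_ _≡_ edge
      edge-joins       : ∀ i → Joins G (edge i) (vertex (inject₁ i)) (vertex (suc i))
      edge-allowed     : ∀ i → P (edge i)
      starts           : vertex zero ≡ x
      ends             : vertex (fromℕ steps) ≡ y

  open Path public

  Within : ∀ {x y} → Subset n → Path x y → Set
  Within R p = ∀ i → lookup R (vertex p i) ≡ true

  trivialPath : ∀ y → Path y y
  trivialPath y = record
    { steps = 0 ; vertex = λ _ → y ; edge = λ () ; vertex-injective = λ { {zero} {zero} _ → refl }
    ; edge-injective = λ { {()} } ; edge-joins = λ () ; edge-allowed = λ () ; starts = refl ; ends = refl }

  prepend : ∀ {R a w x y} (p : Path x y) → Within R p → lookup R w ≡ false → P a → Joins G a w x → Path w y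
  prepend {R} {a} {w} p within w∉R Pa a-joins = record
    { steps = suc (steps p) ; vertex = w Vector.∷ vertex p ; edge = a Vector.∷ edge p
    ; vertex-injective = vertex-injective′ ; edge-injective = edge-injective′
    ; edge-joins = λ { zero → subst (Joins G a w) (sym (starts p)) a-joins ; (suc i) → edge-joins p i }
    ; edge-allowed = λ { zero → Pa ; (suc i) → edge-allowed p i }
    ; starts = refl ; ends = ends p }
    where
      w∉p : ∀ i → w ≢ vertex p i
      w∉p i w≡pᵢ = true≢false (trans (sym (within i)) (trans (cong (lookup R) (sym w≡pᵢ)) w∉R))
      a∉p : ∀ i → a ≢ edge p i
      a∉p i refl with joins-endpoint {G = G} (edge-joins p i) a-joins
      ... | inj₁ w≡pᵢ = w∉p (inject₁ i) w≡pᵢ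
      ... | inj₂ w≡pᵢ₊₁ = w∉p (suc i) w≡pᵢ₊₁
      vertex-injective′ : Injective _≡_ _≡_ (w Vector.∷ vertex p)
      vertex-injective′ {zero} {zero} _ = refl
      vertex-injective′ {zero} {suc j} eq = ⊥-elim (w∉p j eq)
      vertex-injective′ {suc i} {zero} eq = ⊥-elim (w∉p i (sym eq))
      vertex-injective′ {suc i} {suc j} eq = cong suc (vertex-injective p eq)
      edge-injective′ : Injective _≡_ _≡_ (a Vector.∷ edge p)
      edge-injective′ {zero} {zero} _ = refl
      edge-injective′ {zero} {suc j} eq = ⊥-elim (a∉p j eq)
      edge-injective′ {suc i} {zero} eq = ⊥-elim (a∉p i (sym eq))
      edge-injective′ {suc i} {suc j} eq = cong suc (edge-injective p eq)

  closePath : ∀ {a x y} (p : Path x y) → Joins G a y x → (∀ i → edge p i ≢ a) → Circuit G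
  closePath {a} p a-joins fresh = record
    { len = steps p ; verts = vertex p ; edges = edge p ∷ʳ a
    ; verts-inj = vertex-injective p ; edges-inj = edges-injective ; joins = edges-join }
    where
      edges-injective : Injective _≡_ _≡_ (edge p ∷ʳ a)
      edges-injective {i} {j} eq with initOrLast i | initOrLast j
      ... | init i′ | init j′ = cong inject₁ (edge-injective p
            (trans (sym (∷ʳ-inject₁ (edge p) a i′)) (trans eq (∷ʳ-inject₁ (edge p) a j′))))
      ... | init i′ | last =
            ⊥-elim (fresh i′ (trans (sym (∷ʳ-inject₁ (edge p) a i′)) (trans eq (∷ʳ-fromℕ (edge p) a))))
      ... | last | init j′ =
            ⊥-elim (fresh j′ (trans (sym (∷ʳ-inject₁ (edge p) a j′)) (trans (sym eq) (∷ʳ-fromℕ (edge p) a))))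
      ... | last | last = refl
      edges-join : ∀ i → Joins G ((edge p ∷ʳ a) i) (vertex p i) (vertex p (next i))
      edges-join i with initOrLast i
      ... | init j rewrite ∷ʳ-inject₁ (edge p) a j | next-inject₁ j = edge-joins p j
      ... | last rewrite ∷ʳ-fromℕ (edge p) a | next-fromℕ (steps p) | ends p | starts p = a-joins

  closePath-edges : ∀ {a x y} (p : Path x y) (a-joins : Joins G a y x) (fresh : ∀ i → edge p i ≢ a)
    (Q : Fin m → Set) → (∀ i → Q (edge p i)) → Q a → ∀ i → Q (edges (closePath p a-joins fresh) i)
  closePath-edges {a} p _ _ Q Qp Qa i with initOrLast i
  ... | init j = subst Q (sym (∷ʳ-inject₁ (edge p) a j)) (Qp j)
  ... | last = subst Q (sym (∷ʳ-fromℕ (edge p) a)) Qa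

  sign-closePath : ∀ {a x y} (p : Path x y) (a-joins : Joins G a y x) (fresh : ∀ i → edge p i ≢ a) (Γ : Subset m) →
    sign Γ (closePath p a-joins fresh) ≡ xorSum (lookup Γ ∘ edge p) xor lookup Γ a
  sign-closePath {a} p _ _ Γ =
    trans (sum-init-last (lookup Γ ∘ (edge p ∷ʳ a)))
          (cong₂ _xor_ (sum-cong-≗ (cong (lookup Γ) ∘ ∷ʳ-inject₁ (edge p) a)) (cong (lookup Γ) (∷ʳ-fromℕ (edge p) a)))

  Closed : Subset n → Set
  Closed R = ∀ a → P a → lookup R (proj₁ (G a)) ≡ lookup R (proj₂ (G a))

  record Component (y : Fin n) : Set where
    field
      members  : Subset n
      closed   : Closed members
      contains : lookup members y ≡ true
      path     : ∀ x → lookup members x ≡ true → Path x y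

  data Boundary (R : Subset n) : Set where
    exit   : ∀ {a w x} → P a → Joins G a w x → lookup R x ≡ true → lookup R w ≡ false → Boundary R
    sealed : Closed R → Boundary R

  boundary : Decidable P → ∀ R → Boundary R
  boundary P? R with any? (λ a → P? a ×-dec ¬? (lookup R (proj₁ (G a)) Bool.≟ lookup R (proj₂ (G a))))
  ... | no no-exit = sealed λ a Pa →
          decidable-stable (lookup R (proj₁ (G a)) Bool.≟ lookup R (proj₂ (G a))) (λ ne → no-exit (a , Pa , ne))
  ... | yes (a , Pa , ne) with lookup R (proj₁ (G a)) in s∈R | lookup R (proj₂ (G a)) in t∈R
  ...   | true  | false = exit Pa (inj₂ refl) s∈R t∈R
  ...   | false | true  = exit Pa (inj₁ refl) t∈R s∈R
  ...   | true  | true  = ⊥-elim (ne refl)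
  ...   | false | false = ⊥-elim (ne refl)

  Explored : Subset n → Fin n → Set
  Explored R y = lookup R y ≡ true × (∀ x → lookup R x ≡ true → Σ[ p ∈ Path x y ] Within R p)

  explore : ∀ {R a w x y} → Explored R y → P a → Joins G a w x → lookup R x ≡ true → lookup R w ≡ false →
    Explored (R [ w ]≔ true) y
  explore {R} {a} {w} {x} {y} (y∈R , paths) Pa a-joins x∈R w∉R = lookup-insert R w y∈R , paths′
    where
      paths′ : ∀ z → lookup (R [ w ]≔ true) z ≡ true → Σ[ p ∈ Path z y ] Within (R [ w ]≔ true) p
      paths′ z z∈R′ with w ≟ z
      ... | yes refl = let (p , within) = paths x x∈R in
        prepend {R} p within w∉R Pa a-joins ,
        λ { zero → lookup∘update w R true ; (suc i) → lookup-insert R w (within i) }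
      ... | no w≢z = let (p , within) = paths z (trans (sym (lookup∘update′ (w≢z ∘ sym) R true)) z∈R′) in
        p , lookup-insert R w ∘ within

  search : Decidable P → ∀ fuel R {y} → n ≤ fuel + ∣ R ∣ → Explored R y → Component y
  search P? fuel R bound (y∈R , paths) with boundary P? R
  ... | sealed closed = record
    { members = R ; closed = closed ; contains = y∈R ; path = λ x x∈R → proj₁ (paths x x∈R) }
  search P? zero R bound _ | exit {w = w} _ _ _ w∉R =
    ⊥-elim (n≮n ∣ R ∣ (≤-trans (subst (_≤ n) (∣insert∣ R w w∉R) (∣p∣≤n (R [ w ]≔ true))) bound))
  search P? (suc fuel) R bound explored | exit {w = w} Pa a-joins x∈R w∉R =
    search P? fuel (R [ w ]≔ true) bound′ (explore {R} explored Pa a-joins x∈R w∉R)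
    where
      bound′ : n ≤ fuel + ∣ R [ w ]≔ true ∣
      bound′ = subst (n ≤_) (trans (sym (+-suc fuel ∣ R ∣)) (cong (fuel +_) (sym (∣insert∣ R w w∉R)))) bound

  component : Decidable P → ∀ y → Component y
  component P? y = search P? n ⁅ y ⁆ (m≤m+n n ∣ ⁅ y ⁆ ∣) (y∈⁅y⁆ , singleton)
    where
      y∈⁅y⁆ : lookup ⁅ y ⁆ y ≡ true
      y∈⁅y⁆ = []=⇒lookup (x∈⁅x⁆ y)
      singleton : ∀ x → lookup ⁅ y ⁆ x ≡ true → Σ[ p ∈ Path x y ] Within ⁅ y ⁆ p
      singleton x x∈⁅y⁆ with x∈⁅y⁆⇒x≡y y (lookup⇒[]= x ⁅ y ⁆ x∈⁅y⁆)
      ... | refl = trivialPath y , λ _ → y∈⁅y⁆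

-- Harary's balance theorem

module _ {n m} (G : Graph n m) (Σ D : Subset m) where

  open DecMembership (_≟_ {n = m}) using () renaming (_∈?_ to _∈ₗ?_)

  PositiveOn : List (Fin m) → Subset n → Set
  PositiveOn L U = ∀ a → a ∈ₗ L → lookup D a ≡ false → lookup (switch G U Σ) a ≡ false

  positiveOn-∷ : ∀ {e L U} → PositiveOn L U → (lookup D e ≡ false → lookup (switch G U Σ) e ≡ false) →
    PositiveOn (e ∷ L) U
  positiveOn-∷ positive e-positive a (here refl) = e-positive
  positiveOn-∷ positive e-positive a (there a∈L) = positive a a∈L

  -- Switching at the component R of one end of e in the positive edges of L outside D makes e
  -- positive, unless the other end of e is also in R: then a path in R closes up with e into a
  -- negative circuit avoiding D.
  repair-edge : BalancedWithout G Σ D → ∀ e L U → PositiveOn L U → lookup D e ≡ false →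
    lookup (switch G U Σ) e ≡ true → ∃ (PositiveOn (e ∷ L))
  repair-edge balanced e L U positive e∉D e-negative = repair (lookup members (proj₁ (G e))) refl
    where
      open Reachability G (λ a → a ∈ₗ L × lookup D a ≡ false)
      open Component (component (λ a → (a ∈ₗ? L) ×-dec (lookup D a Bool.≟ false)) (proj₂ (G e)))

      Γ : Subset m
      Γ = switch G U Σ

      repair : ∀ b → lookup members (proj₁ (G e)) ≡ b → ∃ (PositiveOn (e ∷ L))
      repair false u∉R = U Δ members , positive′
        where
          positive′ : PositiveOn (e ∷ L) (U Δ members)
          positive′ a (here refl) _ = begin
            lookup (switch G (U Δ members) Σ) e                 ≡⟨ lookup-switch-Δ G U members Σ e ⟩
            lookup Γ e xor lookup (cut G members) e             ≡⟨ cong₂ _xor_ e-negative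
                                                                     (trans (lookup-cut G members e) (cong₂ _xor_ u∉R contains)) ⟩
            false                                                ∎
          positive′ a (there a∈L) a∉D = begin
            lookup (switch G (U Δ members) Σ) a                 ≡⟨ lookup-switch-Δ G U members Σ a ⟩
            lookup Γ a xor lookup (cut G members) a             ≡⟨ cong₂ _xor_ (positive a a∈L a∉D) (uncut a (a∈L , a∉D)) ⟩
            false                                                ∎
            where
              uncut : ∀ a → a ∈ₗ L × lookup D a ≡ false → lookup (cut G members) a ≡ false
              uncut a allowed = trans (lookup-cut G members a)
                (trans (cong (_xor lookup members (proj₂ (G a))) (closed a allowed))
                       (xor-same (lookup members (proj₂ (G a)))))
      repair true u∈R = ⊥-elim (balanced C avoids (Equivalence.from (negative⇔sign Σ C) negativeC))
        where
          p : Path (proj₁ (G e)) (proj₂ (G e))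
          p = path (proj₁ (G e)) u∈R
          positive-p : ∀ i → lookup Γ (edge p i) ≡ false
          positive-p i = positive (edge p i) (proj₁ (edge-allowed p i)) (proj₂ (edge-allowed p i))
          fresh : ∀ i → edge p i ≢ e
          fresh i pᵢ≡e = true≢false (trans (sym e-negative) (subst (λ a → lookup Γ a ≡ false) pᵢ≡e (positive-p i)))
          C : Circuit G
          C = closePath p (inj₂ refl) fresh
          avoids : ∀ i → lookup D (edges C i) ≡ false
          avoids = closePath-edges p (inj₂ refl) fresh (λ a → lookup D a ≡ false) (proj₂ ∘ edge-allowed p) e∉D
          negativeC : sign Σ C ≡ true
          negativeC = begin
            sign Σ C                                  ≡⟨ sym (sign-switch Σ U C) ⟩
            sign Γ C                                  ≡⟨ sign-closePath p (inj₂ refl) fresh Γ ⟩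
            xorSum (lookup Γ ∘ edge p) xor lookup Γ e ≡⟨ cong₂ _xor_ (xorSum-false positive-p) e-negative ⟩
            true                                      ∎

  repair : BalancedWithout G Σ D → ∀ L → ∃ (PositiveOn L)
  repair balanced [] = ⊥ , λ _ ()
  repair balanced (e ∷ L) with repair balanced L
  ... | U , positive with lookup D e in De | lookup (switch G U Σ) e in Γe
  ...   | true  | _     = U , positiveOn-∷ {U = U} positive (λ e∉D → ⊥-elim (true≢false (trans (sym De) e∉D)))
  ...   | false | false = U , positiveOn-∷ {U = U} positive (λ _ → Γe)
  ...   | false | true  = repair-edge balanced e L U positive De Γe

  balanced⇒switch⊆ : BalancedWithout G Σ D → ∃ λ U → switch G U Σ ⊆ D
  balanced⇒switch⊆ balanced with repair balanced (allFin m)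
  ... | U , positive = U , λ {a} a∈Γ → lookup⇒[]= a D (in-D a ([]=⇒lookup a∈Γ))
    where
      in-D : ∀ a → lookup (switch G U Σ) a ≡ true → lookup D a ≡ true
      in-D a Γa with lookup D a in Da
      ... | true = refl
      ... | false = ⊥-elim (true≢false (trans (sym Γa) (positive a (∈-allFin a) Da)))

-- The frustration index as the least size of a signature

subset-argmin : ∀ {k} (f : Subset k → ℕ) → ∃ λ U → ∀ V → f U ≤ f V
subset-argmin {zero} f = [] , λ { [] → ≤-refl }
subset-argmin {suc k} f with subset-argmin (f ∘ (true ∷_)) | subset-argmin (f ∘ (false ∷_))
... | U₁ , min₁ | U₀ , min₀ with f (true ∷ U₁) ≤? f (false ∷ U₀)
...   | yes ≤₀ = true ∷ U₁ , λ { (true ∷ V) → min₁ V ; (false ∷ V) → ≤-trans ≤₀ (min₀ V) }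
...   | no ≰₀ = false ∷ U₀ , λ { (true ∷ V) → ≤-trans (≰⇒≥ ≰₀) (min₁ V) ; (false ∷ V) → min₀ V }

∣switch∣≤ : ∀ {n m} (G : Graph n m) (Σ D : Subset m) → BalancedWithout G Σ D → ∃ λ U → ∣ switch G U Σ ∣ ≤ ∣ D ∣
∣switch∣≤ G Σ D balanced = let (U , Γ⊆D) = balanced⇒switch⊆ G Σ D balanced in U , p⊆q⇒∣p∣≤∣q∣ Γ⊆D

frustration≤∣switch∣ : ∀ {n m} (G : Graph n m) (Σ : Subset m) {k} → Frustration G Σ k → ∀ U → k ≤ ∣ switch G U Σ ∣
frustration≤∣switch∣ G Σ (_ , minimal) U = minimal (switch G U Σ) (switch⊆⇒balanced G Σ _ U ⊆-refl)

frustration-attained : ∀ {n m} (G : Graph n m) (Σ : Subset m) {k} → Frustration G Σ k →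
  ∃ λ U → ∣ switch G U Σ ∣ ≡ k
frustration-attained G Σ F@((D , ∣D∣≡k , balanced) , _) =
  let (U , ∣Γ∣≤∣D∣) = ∣switch∣≤ G Σ D balanced in
  U , ≤-antisym (subst (∣ switch G U Σ ∣ ≤_) ∣D∣≡k ∣Γ∣≤∣D∣) (frustration≤∣switch∣ G Σ F U)

frustration-exists : ∀ {n m} (G : Graph n m) (Σ : Subset m) → ∃ (Frustration G Σ)
frustration-exists G Σ =
  let (U , minimal) = subset-argmin (λ U → ∣ switch G U Σ ∣) in
  ∣ switch G U Σ ∣ ,
  (switch G U Σ , refl , switch⊆⇒balanced G Σ _ U ⊆-refl) ,
  λ D balanced → let (V , ∣Γ∣≤∣D∣) = ∣switch∣≤ G Σ D balanced in ≤-trans (minimal V) ∣Γ∣≤∣D∣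

∣∷∣ : ∀ {k} b (p : Subset k) → ∣ b ∷ p ∣ ≡ bit b + ∣ p ∣
∣∷∣ true p = refl
∣∷∣ false p = refl

∣deleteSig∣ : ∀ {m} (X : Subset (suc m)) e → ∣ X ∣ ≡ bit (lookup X e) + ∣ deleteSig X e ∣
∣deleteSig∣ (x ∷ X) zero = trans (∣∷∣ x X) (cong (λ Y → bit x + ∣ Y ∣) (sym (tabulate∘lookup X)))
∣deleteSig∣ {suc m} (x ∷ X) (suc e) = begin
  ∣ x ∷ X ∣                                          ≡⟨ ∣∷∣ x X ⟩
  bit x + ∣ X ∣                                      ≡⟨ cong (bit x +_) (∣deleteSig∣ X e) ⟩
  bit x + (bit (lookup X e) + ∣ deleteSig X e ∣)     ≡⟨ +-left-comm (bit x) (bit (lookup X e)) _ ⟩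
  bit (lookup X e) + (bit x + ∣ deleteSig X e ∣)     ≡⟨ cong (bit (lookup X e) +_) (sym (∣∷∣ x (deleteSig X e))) ⟩
  bit (lookup X e) + ∣ x ∷ deleteSig X e ∣           ∎

deleteSig-switch : ∀ {n m} (G : Graph n (suc m)) (U : Subset n) (Σ : Subset (suc m)) e →
  deleteSig (switch G U Σ) e ≡ switch (deleteEdge G e) U (deleteSig Σ e)
deleteSig-switch G U Σ e = lookup-extensional λ j → begin
  lookup (deleteSig (switch G U Σ) e) j                             ≡⟨ lookup∘tabulate _ j ⟩
  lookup (switch G U Σ) (punchIn e j)                               ≡⟨ lookup-Δ Σ (cut G U) (punchIn e j) ⟩
  lookup Σ (punchIn e j) xor lookup (cut G U) (punchIn e j)        ≡⟨ cong₂ _xor_ (sym (lookup∘tabulate _ j))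
                                                                       (trans (lookup-cut G U (punchIn e j))
                                                                              (sym (lookup-cut (deleteEdge G e) U j))) ⟩
  lookup (deleteSig Σ e) j xor lookup (cut (deleteEdge G e) U) j   ≡⟨ sym (lookup-Δ (deleteSig Σ e) _ j) ⟩
  lookup (switch (deleteEdge G e) U (deleteSig Σ e)) j             ∎

∣switch∣-deleteEdge : ∀ {n m} (G : Graph n (suc m)) (U : Subset n) (Σ : Subset (suc m)) e →
  ∣ switch G U Σ ∣ ≡ bit (lookup (switch G U Σ) e) + ∣ switch (deleteEdge G e) U (deleteSig Σ e) ∣
∣switch∣-deleteEdge G U Σ e =
  trans (∣deleteSig∣ (switch G U Σ) e) (cong (λ X → bit (lookup (switch G U Σ) e) + ∣ X ∣) (deleteSig-switch G U Σ e))

∣pΔq∣+∣q∩p∣≡∣p∣+∣q∩∁p∣ : ∀ {k} (p q : Subset k) → ∣ p Δ q ∣ + ∣ q ∩ p ∣ ≡ ∣ p ∣ + ∣ q ∩ ∁ p ∣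
∣pΔq∣+∣q∩p∣≡∣p∣+∣q∩∁p∣ [] [] = refl
∣pΔq∣+∣q∩p∣≡∣p∣+∣q∩∁p∣ (false ∷ p) (false ∷ q) = ∣pΔq∣+∣q∩p∣≡∣p∣+∣q∩∁p∣ p q
∣pΔq∣+∣q∩p∣≡∣p∣+∣q∩∁p∣ (true ∷ p) (false ∷ q) = cong suc (∣pΔq∣+∣q∩p∣≡∣p∣+∣q∩∁p∣ p q)
∣pΔq∣+∣q∩p∣≡∣p∣+∣q∩∁p∣ (false ∷ p) (true ∷ q) =
  trans (cong suc (∣pΔq∣+∣q∩p∣≡∣p∣+∣q∩∁p∣ p q)) (sym (+-suc ∣ p ∣ ∣ q ∩ ∁ p ∣))
∣pΔq∣+∣q∩p∣≡∣p∣+∣q∩∁p∣ (true ∷ p) (true ∷ q) =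
  trans (+-suc ∣ p Δ q ∣ ∣ q ∩ p ∣) (cong suc (∣pΔq∣+∣q∩p∣≡∣p∣+∣q∩∁p∣ p q))

equilibrated⇔∣switch∣≡ : ∀ {n m} (G : Graph n m) (Γ : Subset m) (W : Subset n) →
  Equilibrated G Γ W ⇔ ∣ switch G W Γ ∣ ≡ ∣ Γ ∣
equilibrated⇔∣switch∣≡ {m = m} G Γ W = mk⇔
  (λ equilibrated → +-cancelʳ-≡ ∣ c ∩ Γ ∣ _ _ (trans counting (cong (∣ Γ ∣ +_) (sym equilibrated))))
  (λ same-size → +-cancelˡ-≡ ∣ Γ ∣ _ _ (trans (cong (_+ ∣ c ∩ Γ ∣) (sym same-size)) counting))
  where
    c : Subset m
    c = cut G W
    counting : ∣ Γ Δ c ∣ + ∣ c ∩ Γ ∣ ≡ ∣ Γ ∣ + ∣ c ∩ ∁ Γ ∣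
    counting = ∣pΔq∣+∣q∩p∣≡∣p∣+∣q∩∁p∣ Γ c

CoveredByKSignatures : ∀ {n m} → Graph n m → Subset m → ℕ → Set
CoveredByKSignatures {m = m} G Σ k = ∀ (e : Fin m) → ∃ λ (Γ : Subset m) → IsKSignature G Σ k Γ × e ∈ Γ

CoveredByEquilibratedCuts : ∀ {n m} → Graph n m → Subset m → ℕ → Set
CoveredByEquilibratedCuts {n} {m} G Σ k = ∀ (Γ : Subset m) → IsKSignature G Σ k Γ → ∀ (e : Fin m) → e ∉ Γ →
  ∃ λ (U : Subset n) → e ∈ cut G U × Equilibrated G Γ U

∉⇒lookup-false : ∀ {k} {x} (p : Subset k) → x ∉ p → lookup p x ≡ false
∉⇒lookup-false {x = x} p x∉p = ¬-not (x∉p ∘ lookup⇒[]= x p)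

deletionBelow⇒inKSignature : ∀ {n m} (G : Graph n m) (Σ : Subset m) {k} → Frustration G Σ k →
  ∀ e → DeletionBelow G Σ e k → ∃ λ Γ → IsKSignature G Σ k Γ × e ∈ Γ
deletionBelow⇒inKSignature {m = suc m} G Σ {k} F e (j , j<k , F′) =
  let (U , ∣Γ′∣≡j) = frustration-attained (deleteEdge G e) (deleteSig Σ e) F′ in
  inKSignature U (lookup (switch G U Σ) e) refl
    (trans (∣switch∣-deleteEdge G U Σ e) (cong (bit (lookup (switch G U Σ) e) +_) ∣Γ′∣≡j))
  where
    inKSignature : ∀ U b → lookup (switch G U Σ) e ≡ b → ∣ switch G U Σ ∣ ≡ bit b + j →
      ∃ λ Γ → IsKSignature G Σ k Γ × e ∈ Γ
    inKSignature U false _ ∣Γ∣≡j = ⊥-elim (n≮n j (<-≤-trans j<k (subst (k ≤_) ∣Γ∣≡j (frustration≤∣switch∣ G Σ F U))))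
    inKSignature U true Γe ∣Γ∣≡1+j = switch G U Σ ,
      ((U , refl) , ≤-antisym (subst (_≤ k) (sym ∣Γ∣≡1+j) j<k) (frustration≤∣switch∣ G Σ F U)) ,
      lookup⇒[]= e (switch G U Σ) Γe

inKSignature⇒deletionBelow : ∀ {n m} (G : Graph n m) (Σ : Subset m) {k} →
  ∀ e → (∃ λ Γ → IsKSignature G Σ k Γ × e ∈ Γ) → DeletionBelow G Σ e k
inKSignature⇒deletionBelow {m = suc m} G Σ e (.(switch G U Σ) , ((U , refl) , ∣Γ∣≡k) , e∈Γ) =
  let (j , F′) = frustration-exists (deleteEdge G e) (deleteSig Σ e) in
  j ,
  subst (j <_) ∣Γ∣≡k
    (≤-<-trans (frustration≤∣switch∣ (deleteEdge G e) (deleteSig Σ e) F′ U) (≤-reflexive (sym ∣Γ∣≡1+∣Γ′∣))) ,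
  F′
  where
    ∣Γ∣≡1+∣Γ′∣ : ∣ switch G U Σ ∣ ≡ suc ∣ switch (deleteEdge G e) U (deleteSig Σ e) ∣
    ∣Γ∣≡1+∣Γ′∣ = trans (∣switch∣-deleteEdge G U Σ e)
      (cong (λ b → bit b + ∣ switch (deleteEdge G e) U (deleteSig Σ e) ∣) ([]=⇒lookup e∈Γ))

critical⇔coveredByKSignatures : ∀ {n m} (G : Graph n m) (Σ : Subset m) {k} → Frustration G Σ k →
  Critical G Σ k ⇔ CoveredByKSignatures G Σ k
critical⇔coveredByKSignatures G Σ F = mk⇔
  (λ (_ , below) e → deletionBelow⇒inKSignature G Σ F e (below e))
  (λ covered → F , λ e → inKSignature⇒deletionBelow G Σ e (covered e))

coveredByKSignatures⇒coveredByEquilibratedCuts : ∀ {n m} (G : Graph n m) (Σ : Subset m) {k} →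
  CoveredByKSignatures G Σ k → CoveredByEquilibratedCuts G Σ k
coveredByKSignatures⇒coveredByEquilibratedCuts {n} {m} G Σ covered .(switch G U₀ Σ) ((U₀ , refl) , ∣Γ₀∣≡k) e e∉Γ₀
  with covered e
... | .(switch G U₁ Σ) , ((U₁ , refl) , ∣Γ₁∣≡k) , e∈Γ₁ =
  W , lookup⇒[]= e (cut G W) e∈cut ,
  Equivalence.from (equilibrated⇔∣switch∣≡ G Γ₀ W) (trans (cong ∣_∣ (sym Γ₁≡)) (trans ∣Γ₁∣≡k (sym ∣Γ₀∣≡k)))
  where
    W : Subset n
    W = U₀ Δ U₁
    Γ₀ : Subset m
    Γ₀ = switch G U₀ Σ
    Γ₁≡ : switch G U₁ Σ ≡ switch G W Γ₀
    Γ₁≡ = switch-difference G U₀ U₁ Σ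
    e∈cut : lookup (cut G W) e ≡ true
    e∈cut = begin
      lookup (cut G W) e                   ≡⟨ cong (_xor lookup (cut G W) e) (sym (∉⇒lookup-false Γ₀ e∉Γ₀)) ⟩
      lookup Γ₀ e xor lookup (cut G W) e   ≡⟨ sym (lookup-Δ Γ₀ (cut G W) e) ⟩
      lookup (switch G W Γ₀) e             ≡⟨ cong (λ Γ → lookup Γ e) (sym Γ₁≡) ⟩
      lookup (switch G U₁ Σ) e             ≡⟨ []=⇒lookup e∈Γ₁ ⟩
      true                                 ∎

switch-along-equilibrated : ∀ {n m} (G : Graph n m) (Σ : Subset m) (U W : Subset n) {e} →
  e ∉ switch G U Σ → e ∈ cut G W → Equilibrated G (switch G U Σ) W →
  ∣ switch G (U Δ W) Σ ∣ ≡ ∣ switch G U Σ ∣ × e ∈ switch G (U Δ W) Σ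
switch-along-equilibrated G Σ U W {e} e∉Γ e∈cut equilibrated =
  trans (cong ∣_∣ (switch-Δ G U W Σ)) (Equivalence.to (equilibrated⇔∣switch∣≡ G (switch G U Σ) W) equilibrated) ,
  lookup⇒[]= e (switch G (U Δ W) Σ)
    (trans (lookup-switch-Δ G U W Σ e) (cong₂ _xor_ (∉⇒lookup-false (switch G U Σ) e∉Γ) ([]=⇒lookup e∈cut)))

coveredByEquilibratedCuts⇒coveredByKSignatures : ∀ {n m} (G : Graph n m) (Σ : Subset m) {k} → Frustration G Σ k →
  CoveredByEquilibratedCuts G Σ k → CoveredByKSignatures G Σ k
coveredByEquilibratedCuts⇒coveredByKSignatures G Σ {k} F covered e =
  let (U , ∣Γ∣≡k) = frustration-attained G Σ F in cover U ∣Γ∣≡k (e ∈? switch G U Σ)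
  where
    cover : ∀ U → ∣ switch G U Σ ∣ ≡ k → Dec (e ∈ switch G U Σ) → ∃ λ Γ → IsKSignature G Σ k Γ × e ∈ Γ
    cover U ∣Γ∣≡k (yes e∈Γ) = switch G U Σ , ((U , refl) , ∣Γ∣≡k) , e∈Γ
    cover U ∣Γ∣≡k (no e∉Γ) =
      let (W , e∈cut , equilibrated) = covered (switch G U Σ) ((U , refl) , ∣Γ∣≡k) e e∉Γ
          (same-size , e∈Γ′) = switch-along-equilibrated G Σ U W e∉Γ e∈cut equilibrated
      in switch G (U Δ W) Σ , ((U Δ W , refl) , trans same-size ∣Γ∣≡k) , e∈Γ′

theorem2p2 : ∀ {n m : ℕ} (G : Graph n m) (Σ : Subset m) (k : ℕ) → 1 ≤ k → Frustration G Σ k →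
    (Critical G Σ k ⇔ (∀ (e : Fin m) → ∃ λ (Γ : Subset m) → IsKSignature G Σ k Γ × e ∈ Γ))
    × (Critical G Σ k ⇔ (∀ (Γ : Subset m) → IsKSignature G Σ k Γ → ∀ (e : Fin m) → e ∉ Γ →
    ∃ λ (U : Subset n) → e ∈ cut G U × Equilibrated G Γ U))
theorem2p2 G Σ k _ F =
  critical⇔covered ,
  mk⇔ (coveredByKSignatures⇒coveredByEquilibratedCuts G Σ ∘ to)
      (from ∘ coveredByEquilibratedCuts⇒coveredByKSignatures G Σ F)
  where
    critical⇔covered : Critical G Σ k ⇔ CoveredByKSignatures G Σ k
    critical⇔covered = critical⇔coveredByKSignatures G Σ F
    open Equivalence critical⇔covered
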